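{- Let $d \ge 0$, $c \ge -2d$, and $b \ge 0$ be integers, not all $0$. Define $a_i = 2di + c$ for $i = 1,\ldots,n-2$ and $a_{n-1} = 2d(n-1) + c + b$. Let \[ C \defeq \{ x \in \mathbf{R}^n \mid \forall \pi \in S_{n-1},\ \epsilon \in \{\pm1\}^{n-1} : \epsilon_1 a_1 x_{\pi(1)} + \cdots + \epsilon_{n-1} a_{n-1} x_{\pi(n-1)} \le x_n \}, \] and let $f_C(t) \defeq \sum_{x \in C \cap \mathbf{Z}^n} t^{x_n}$. Then \[ f_C(t) = \frac{1}{1-t} \sum_{\lambda \in L_{n-1}} t^{\sum_{i=1}^{n-1} a_i \lceil \lambda_i/(2i) \rceil} . \]
   Context: $L_m \defeq \{ \lambda \in \mathbf{Z}^m \mid 0 \le \lambda_1/1 \le \lambda_2/2 \le \cdots \le \lambda_m/m \}$ is the set of lecture hall partitions of length $m$. $\lceil x \rceil$ is the least integer $\ge x$. $S_{n-1}$ is the symmetric group on $\{1,\ldots,n-1\}$. The identity is as formal power series / rational functions in $t$. -}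

module Defs where

open import Data.Nat as ℕ using (ℕ; zero; suc; _≡ᵇ_)
open import Data.Integer as ℤ using (ℤ; +_; -_)
open import Data.Rational as ℚ using (ℚ; 0ℚ; ceiling)
open import Data.Fin using (Fin; zero; suc; toℕ; inject₁)
open import Data.Fin.Permutation using (Permutation′; _⟨$⟩ʳ_)
open import Data.Vec using (Vec; lookup)
open import Data.Sign using (Sign)
open import Data.Bool using (if_then_else_)
open import Relation.Binary.PropositionalEquality using (_≡_)

sumℤ : ∀ {m} → (Fin m → ℤ) → ℤ
sumℤ {zero}  f = + 0
sumℤ {suc m} f = f zero ℤ.+ sumℤ (λ i → f (suc i))

applySign : Sign → ℤ → ℤ
applySign Sign.+ z = z
applySign Sign.- z = - z

-- Here m = n - 1 and the index i : Fin m stands for i+1 ∈ {1,…,m}.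
-- a_i = 2 d i + c  for i = 1,…,m-1 ;  a_m = 2 d m + c + b
coeff : (m d : ℕ) (c : ℤ) (b : ℕ) → Fin m → ℤ
coeff m d c b i =
  (+ (2 ℕ.* d ℕ.* suc (toℕ i)) ℤ.+ c) ℤ.+ (if suc (toℕ i) ≡ᵇ m then + b else + 0)

-- Integer points of C with last coordinate x_n = k, where x = (x_1,…,x_{n-1}):
-- for all π ∈ S_{n-1}, ε ∈ {±1}^{n-1}: Σ_i ε_i a_i x_{π(i)} ≤ x_n
InC : (m d : ℕ) (c : ℤ) (b : ℕ) → Vec ℤ m → ℤ → Set
InC m d c b x k =
  (π : Permutation′ m) (ε : Fin m → Sign) →
  sumℤ (λ i → applySign (ε i) (coeff m d c b i ℤ.* lookup x (π ⟨$⟩ʳ i))) ℤ.≤ k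

ratio : ∀ {m} → Vec ℤ m → Fin m → ℚ
ratio l i = lookup l i ℚ./ suc (toℕ i)

-- the term preceding λ_i / i in the chain 0 ≤ λ_1/1 ≤ λ_2/2 ≤ ⋯ ≤ λ_m/m
prevRatio : ∀ {m} → Vec ℤ m → Fin m → ℚ
prevRatio l zero    = 0ℚ
prevRatio l (suc j) = ratio l (inject₁ j)

LectureHall : (m : ℕ) → Vec ℤ m → Set
LectureHall m l = (i : Fin m) → prevRatio l i ℚ.≤ ratio l i

lhExponent : (m d : ℕ) (c : ℤ) (b : ℕ) → Vec ℤ m → ℤ
lhExponent m d c b l =
  sumℤ (λ i → coeff m d c b i ℤ.* ceiling (lookup l i ℚ./ (2 ℕ.* suc (toℕ i))))

record SubsetBijection {A B : Set} (P : A → Set) (Q : B → Set) : Set where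
  field
    to       : A → B
    from     : B → A
    to-mem   : ∀ a → P a → Q (to a)
    from-mem : ∀ b → Q b → P (from b)
    from∘to  : ∀ a → P a → from (to a) ≡ a
    to∘from  : ∀ b → Q b → to (from b) ≡ b

-- Remove from x the entry of largest absolute value v (ties broken by sign, then position) and
-- record it as the last part λ_m = 2m(v - 1) + o + 1 of a partition, where the digit o < 2m encodes
-- the sign and position of the entry, so that ⌈λ_m / 2m⌉ = v; recurse on the remaining entries.
-- Because entries are removed in decreasing order, consecutive parts satisfy λ_i / i ≤ λ_(i+1) / (i+1),
-- and every lecture hall partition decodes to a unique vector. Since 0 ≤ a_1 ≤ ⋯ ≤ a_(n-1), the
-- maximum of Σ ε_i a_i x_π(i) over signs and permutations is Σ a_i |x|_(i), the absolute values sorted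
-- increasingly (rearrangement inequality), and this is exactly Σ a_i ⌈λ_i / 2i⌉ for the image λ.

module Submission where

open import Defs
open import Data.Nat as ℕ
  using (ℕ; zero; suc; _+_; _*_; _∸_; _≤_; _<_; _≡ᵇ_; z≤n; s≤s; NonZero)
import Data.Nat.Properties as ℕ
open import Data.Nat.DivMod using (_/_; _%_)
import Data.Nat.DivMod as ℕ
open import Data.Nat.Coprimality using (Coprime)
open import Data.Nat.Tactic.RingSolver using () renaming (solve-∀ to ℕ-solve)
open import Data.Integer as ℤ using (ℤ; +_; -[1+_]; +[1+_]; -_; ∣_∣; +≤+; +<+; -≤+)
import Data.Integer.Properties as ℤ
import Data.Integer.DivMod as ℤ
import Algebra.Properties.CommutativeSemigroup ℤ.+-commutativeSemigroup as ℤ+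
open import Data.Integer.Tactic.RingSolver using () renaming (solve-∀ to ℤ-solve)
open import Data.Rational as ℚ using (mkℚ; ceiling)
import Data.Rational.Properties as ℚ
import Data.Rational.Unnormalised as ℚᵘ
import Data.Rational.Unnormalised.Properties as ℚᵘ
open import Data.Fin as Fin
  using (Fin; zero; suc; toℕ; inject₁; fromℕ; fromℕ<; punchIn; punchOut)
import Data.Fin.Properties as Fin
open import Data.Fin.Relation.Unary.Top using (View; view; ‵fromℕ; ‵inject₁)
open import Data.Fin.Permutation as Perm using (Permutation′; _⟨$⟩ʳ_; _⟨$⟩ˡ_)
open import Data.Vec as Vec using (Vec; []; _∷_; lookup; _∷ʳ_; init; last; insertAt; removeAt)
import Data.Vec.Properties as Vec
open import Data.Sign as Sign using (Sign)
open import Data.Bool using (true; false; if_then_else_; T)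
open import Data.Unit using (tt)
open import Data.Empty using (⊥-elim)
open import Data.Product using (_×_; _,_; proj₁; proj₂; map₁; Σ)
open import Data.Sum using (_⊎_; inj₁; inj₂)
open import Function using (_∘_; _⇔_; mk⇔; Equivalence)
open import Relation.Binary.Core using (_Preserves_⟶_)
open import Relation.Binary.Definitions using (tri<; tri≈; tri>)
open import Relation.Binary.PropositionalEquality
open import Relation.Nullary using (¬_; yes; no)

lookup-∷ʳ-inject₁ : ∀ {A : Set} {n} (xs : Vec A n) z i → lookup (xs ∷ʳ z) (inject₁ i) ≡ lookup xs i
lookup-∷ʳ-inject₁ (x ∷ xs) z zero    = refl
lookup-∷ʳ-inject₁ (x ∷ xs) z (suc i) = lookup-∷ʳ-inject₁ xs z i

lookup-∷ʳ-fromℕ : ∀ {A : Set} {n} (xs : Vec A n) z → lookup (xs ∷ʳ z) (fromℕ n) ≡ z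
lookup-∷ʳ-fromℕ []       z = refl
lookup-∷ʳ-fromℕ (x ∷ xs) z = lookup-∷ʳ-fromℕ xs z

init-∷ʳ-last : ∀ {A : Set} {n} (xs : Vec A (suc n)) → init xs ∷ʳ last xs ≡ xs
init-∷ʳ-last xs = sym (proj₂ (proj₂ (Vec.initLast xs)))

lookup-removeAt : ∀ {A : Set} {n} (xs : Vec A (suc n)) i j →
  lookup (removeAt xs i) j ≡ lookup xs (punchIn i j)
lookup-removeAt xs i j =
  trans (cong (lookup (removeAt xs i)) (sym (Fin.punchOut-punchIn i)))
        (Vec.removeAt-punchOut xs (Fin.punchInᵢ≢i i j ∘ sym))

Shifted : (g p q : ℕ) → Set
Shifted g p q = (p < g × q ≡ p) ⊎ (g ≤ p × q ≡ suc p)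

shifted-< : ∀ {g p q m} → Shifted g p q → p < m → q < suc m
shifted-< (inj₁ (_ , refl)) p<m = ℕ.m<n⇒m<1+n p<m
shifted-< (inj₂ (_ , refl)) p<m = s≤s p<m

shifted-≤ : ∀ {g p q} → Shifted g p q → p ≤ q
shifted-≤ (inj₁ (_ , refl)) = ℕ.≤-refl
shifted-≤ (inj₂ (_ , refl)) = ℕ.n≤1+n _

toℕ-punchIn : ∀ {n} (i : Fin (suc n)) (j : Fin n) → Shifted (toℕ i) (toℕ j) (toℕ (punchIn i j))
toℕ-punchIn zero    j       = inj₂ (z≤n , refl)
toℕ-punchIn (suc i) zero    = inj₁ (s≤s z≤n , refl)
toℕ-punchIn (suc i) (suc j) with toℕ-punchIn i j
... | inj₁ (j<i , eq) = inj₁ (s≤s j<i , cong suc eq)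
... | inj₂ (i≤j , eq) = inj₂ (s≤s i≤j , cong suc eq)

punchIn-fromℕ : ∀ {n} (j : Fin n) → punchIn (fromℕ n) j ≡ inject₁ j
punchIn-fromℕ zero    = refl
punchIn-fromℕ (suc j) = cong suc (punchIn-fromℕ j)

punchIn-inject₁ : ∀ {n} (i : Fin (suc n)) (j : Fin n) → punchIn (inject₁ i) (inject₁ j) ≡ inject₁ (punchIn i j)
punchIn-inject₁ zero    j       = refl
punchIn-inject₁ (suc i) zero    = refl
punchIn-inject₁ (suc i) (suc j) = cong suc (punchIn-inject₁ i j)

punchIn-inject₁-fromℕ : ∀ {n} (i : Fin (suc n)) → punchIn (inject₁ i) (fromℕ n) ≡ fromℕ (suc n)
punchIn-inject₁-fromℕ {zero}  zero    = refl
punchIn-inject₁-fromℕ {suc n} zero    = refl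
punchIn-inject₁-fromℕ {suc n} (suc i) = cong suc (punchIn-inject₁-fromℕ i)

sumℤ-cong : ∀ {m} {f g : Fin m → ℤ} → (∀ i → f i ≡ g i) → sumℤ f ≡ sumℤ g
sumℤ-cong {zero}  eq = refl
sumℤ-cong {suc m} eq = cong₂ ℤ._+_ (eq zero) (sumℤ-cong (eq ∘ suc))

sumℤ-mono-≤ : ∀ {m} {f g : Fin m → ℤ} → (∀ i → f i ℤ.≤ g i) → sumℤ f ℤ.≤ sumℤ g
sumℤ-mono-≤ {zero}  le = ℤ.≤-refl
sumℤ-mono-≤ {suc m} le = ℤ.+-mono-≤ (le zero) (sumℤ-mono-≤ (le ∘ suc))

sumℤ-punchIn : ∀ {m} (f : Fin (suc m) → ℤ) j → sumℤ f ≡ f j ℤ.+ sumℤ (f ∘ punchIn j)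
sumℤ-punchIn         f zero    = refl
sumℤ-punchIn {suc m} f (suc j) = begin
  f zero ℤ.+ sumℤ (f ∘ suc)                                 ≡⟨ cong (ℤ._+_ (f zero)) (sumℤ-punchIn (f ∘ suc) j) ⟩
  f zero ℤ.+ (f (suc j) ℤ.+ sumℤ (f ∘ suc ∘ punchIn j))     ≡⟨ ℤ+.x∙yz≈y∙xz (f zero) (f (suc j)) _ ⟩
  f (suc j) ℤ.+ (f zero ℤ.+ sumℤ (f ∘ suc ∘ punchIn j))     ∎
  where open ≡-Reasoning

sumℤ-fromℕ : ∀ {m} (f : Fin (suc m) → ℤ) → sumℤ f ≡ sumℤ (f ∘ inject₁) ℤ.+ f (fromℕ m)
sumℤ-fromℕ {m} f = begin
  sumℤ f
    ≡⟨ sumℤ-punchIn f (fromℕ m) ⟩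
  f (fromℕ m) ℤ.+ sumℤ (f ∘ punchIn (fromℕ m))
    ≡⟨ cong (ℤ._+_ (f (fromℕ m))) (sumℤ-cong (cong f ∘ punchIn-fromℕ)) ⟩
  f (fromℕ m) ℤ.+ sumℤ (f ∘ inject₁)
    ≡⟨ ℤ.+-comm (f (fromℕ m)) _ ⟩
  sumℤ (f ∘ inject₁) ℤ.+ f (fromℕ m)
    ∎
  where open ≡-Reasoning

argmax : ∀ {m} → (Fin (suc m) → ℕ) → Fin (suc m)
argmax {zero}  f = zero
argmax {suc m} f with f zero ℕ.≤? f (suc (argmax (f ∘ suc)))
... | yes _ = suc (argmax (f ∘ suc))
... | no  _ = zero

f≤f[argmax] : ∀ {m} (f : Fin (suc m) → ℕ) i → f i ≤ f (argmax f)
f≤f[argmax] {zero}  f zero = ℕ.≤-refl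
f≤f[argmax] {suc m} f i with f zero ℕ.≤? f (suc (argmax (f ∘ suc)))
f≤f[argmax] {suc m} f zero    | yes f₀≤ = f₀≤
f≤f[argmax] {suc m} f (suc i) | yes _   = f≤f[argmax] (f ∘ suc) i
f≤f[argmax] {suc m} f zero    | no  _   = ℕ.≤-refl
f≤f[argmax] {suc m} f (suc i) | no  f₀≰ = ℕ.≤-trans (f≤f[argmax] (f ∘ suc) i) (ℕ.<⇒≤ (ℕ.≰⇒> f₀≰))

-- Mixed-radix numbers

module _ (D : ℕ) where

  radix-< : ∀ {a b} r {r′} → r′ < D → b < a → b * D + r′ < a * D + r
  radix-< {a} {b} r {r′} r′<D b<a = begin-strict
    b * D + r′   <⟨ ℕ.+-monoʳ-< (b * D) r′<D ⟩
    b * D + D    ≡⟨ ℕ.+-comm (b * D) D ⟩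
    suc b * D    ≤⟨ ℕ.*-monoˡ-≤ D b<a ⟩
    a * D        ≤⟨ ℕ.m≤m+n (a * D) r ⟩
    a * D + r    ∎
    where open ℕ.≤-Reasoning

  radix-cancel-≤ : ∀ a b {r r′} → r′ < D → a * D + r ≤ b * D + r′ → a ≤ b
  radix-cancel-≤ a b {r} r′<D le with a ℕ.≤? b
  ... | yes a≤b = a≤b
  ... | no  a≰b = ⊥-elim (ℕ.<⇒≱ (radix-< r r′<D (ℕ.≰⇒> a≰b)) le)

  radix-cancel-< : ∀ a b {r r′} → r′ < D → a * D + r < b * D + r′ → a < b ⊎ (a ≡ b × r < r′)
  radix-cancel-< a b {r} {r′} r′<D lt with ℕ.<-cmp a b
  ... | tri< a<b _ _ = inj₁ a<b
  ... | tri≈ _ refl _ = inj₂ (refl , ℕ.+-cancelˡ-< (a * D) r r′ lt)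
  ... | tri> _ _ b<a = ⊥-elim (ℕ.<-asym lt (radix-< r r′<D b<a))

  radix-/-% : ∀ v {o} .{{_ : NonZero D}} → o < D → (v * D + o) / D ≡ v × (v * D + o) % D ≡ o
  radix-/-% v {o} o<D = quotient , remainder
    where
    remainder : (v * D + o) % D ≡ o
    remainder = begin
      (v * D + o) % D   ≡⟨ cong (_% D) (ℕ.+-comm (v * D) o) ⟩
      (o + v * D) % D   ≡⟨ ℕ.[m+kn]%n≡m%n o v D ⟩
      o % D             ≡⟨ ℕ.m<n⇒m%n≡m o<D ⟩
      o                 ∎
      where open ≡-Reasoning
    quotient : (v * D + o) / D ≡ v
    quotient = ℕ.*-cancelʳ-≡ _ v D (ℕ.+-cancelˡ-≡ o _ _ (begin
      o + (v * D + o) / D * D                 ≡⟨ cong (_+ (v * D + o) / D * D) remainder ⟨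
      (v * D + o) % D + (v * D + o) / D * D   ≡⟨ ℕ.m≡m%n+[m/n]*n (v * D + o) D ⟨
      v * D + o                               ≡⟨ ℕ.+-comm (v * D) o ⟩
      o + v * D                               ∎))
      where open ≡-Reasoning

  radix-injectiveʳ : ∀ a b {r r′} .{{_ : NonZero D}} → r < D → r′ < D →
    a * D + r ≡ b * D + r′ → r ≡ r′
  radix-injectiveʳ a b {r} {r′} r<D r′<D eq = begin
    r                 ≡⟨ proj₂ (radix-/-% a r<D) ⟨
    (a * D + r) % D   ≡⟨ cong (_% D) eq ⟩
    (b * D + r′) % D  ≡⟨ proj₂ (radix-/-% b r′<D) ⟩
    r′                ∎
    where open ≡-Reasoning

-- Rationals: cross-multiplication and ceilings

-- `i ℚ./ suc a` normalises the unnormalised `mkℚᵘ i a`, whose order is cross-multiplication.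
/-≤-/ : ∀ i j a b → (i ℚ./ suc a ℚ.≤ j ℚ./ suc b) ⇔ (i ℤ.* + suc b ℤ.≤ j ℤ.* + suc a)
/-≤-/ i j a b = mk⇔
  (λ le → ℚᵘ.drop-*≤* (ℚᵘ.≤-respʳ-≃ (ℚ.toℚᵘ-fromℚᵘ q)
                        (ℚᵘ.≤-respˡ-≃ (ℚ.toℚᵘ-fromℚᵘ p) (ℚ.toℚᵘ-mono-≤ le))))
  (λ le → ℚ.toℚᵘ-cancel-≤ (ℚᵘ.≤-respʳ-≃ (ℚᵘ.≃-sym (ℚ.toℚᵘ-fromℚᵘ q))
                            (ℚᵘ.≤-respˡ-≃ (ℚᵘ.≃-sym (ℚ.toℚᵘ-fromℚᵘ p)) (ℚᵘ.*≤* le))))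
  where
  p = ℚᵘ.mkℚᵘ i a
  q = ℚᵘ.mkℚᵘ j b

private
  ceiling-mkℚ≡ : ∀ n d .(c : Coprime ∣ n ∣ (suc d)) → ceiling (mkℚ n d c) ≡ - ((- n) ℤ./ + suc d)
  ceiling-mkℚ≡ (+ zero)   d c = refl
  ceiling-mkℚ≡ +[1+ n ]   d c = refl
  ceiling-mkℚ≡ -[1+ n ]   d c = refl

ceiling-mkℚ : ∀ n d .(c : Coprime ∣ n ∣ (suc d)) → let ⌈q⌉ = ceiling (mkℚ n d c) in
  ℤ.pred ⌈q⌉ ℤ.* + suc d ℤ.< n × n ℤ.≤ ⌈q⌉ ℤ.* + suc d
ceiling-mkℚ n d c rewrite ceiling-mkℚ≡ n d c = below , above
  where
  D = + suc d
  w = (- n) ℤ./ D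
  r = (- n) ℤ.% D
  r<D : + r ℤ.< D
  r<D = +<+ (ℤ.n%d<d (- n) D)
  ⌈q⌉*D≡n+r : - w ℤ.* D ≡ n ℤ.+ + r
  ⌈q⌉*D≡n+r = begin
    - w ℤ.* D                    ≡⟨ ring₁ (+ r) w D ⟩
    - (+ r ℤ.+ w ℤ.* D) ℤ.+ + r  ≡⟨ cong (λ t → - t ℤ.+ + r) (ℤ.a≡a%n+[a/n]*n (- n) D) ⟨
    - - n ℤ.+ + r                ≡⟨ cong (ℤ._+ + r) (ℤ.neg-involutive n) ⟩
    n ℤ.+ + r                    ∎
    where
    open ≡-Reasoning
    ring₁ : ∀ r w D → - w ℤ.* D ≡ - (r ℤ.+ w ℤ.* D) ℤ.+ r
    ring₁ = ℤ-solve
  above : n ℤ.≤ - w ℤ.* D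
  above = ℤ.≤-trans (ℤ.i≤i+j n (+ r)) (ℤ.≤-reflexive (sym ⌈q⌉*D≡n+r))
  below : ℤ.pred (- w) ℤ.* D ℤ.< n
  below = begin-strict
    ℤ.pred (- w) ℤ.* D     ≡⟨ ring₂ w D ⟩
    - w ℤ.* D ℤ.- D        ≡⟨ cong (ℤ._- D) ⌈q⌉*D≡n+r ⟩
    n ℤ.+ + r ℤ.- D        <⟨ ℤ.+-monoˡ-< (- D) (ℤ.+-monoʳ-< n r<D) ⟩
    n ℤ.+ D ℤ.- D          ≡⟨ ring₃ n D ⟩
    n                      ∎
    where
    open ℤ.≤-Reasoning
    ring₂ : ∀ w D → (ℤ.-1ℤ ℤ.+ - w) ℤ.* D ≡ - w ℤ.* D ℤ.- D
    ring₂ = ℤ-solve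
    ring₃ : ∀ n D → n ℤ.+ D ℤ.- D ≡ n
    ring₃ = ℤ-solve

private
  ≤-*-of-same-/ : ∀ {n d i a} → n ℚ./ suc d ≡ i ℚ./ suc a →
    ∀ c → n ℤ.≤ c ℤ.* + suc d → i ℤ.≤ c ℤ.* + suc a
  ≤-*-of-same-/ {n} {d} {i} {a} same c n≤ =
    subst (ℤ._≤ c ℤ.* + suc a) (ℤ.*-identityʳ i)
      (Equivalence.to (/-≤-/ i c a 0)
        (subst (ℚ._≤ c ℚ./ 1) same
          (Equivalence.from (/-≤-/ n c d 0) (subst (ℤ._≤ c ℤ.* + suc d) (sym (ℤ.*-identityʳ n)) n≤))))

ceiling-/ : ∀ i a → let ⌈q⌉ = ceiling (i ℚ./ suc a) in
  ℤ.pred ⌈q⌉ ℤ.* + suc a ℤ.< i × i ℤ.≤ ⌈q⌉ ℤ.* + suc a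
ceiling-/ i a with i ℚ./ suc a in eq
... | q@(mkℚ n d cop) = below , above
  where
  same : n ℚ./ suc d ≡ i ℚ./ suc a
  same = trans (ℚ.fromℚᵘ-toℚᵘ q) (sym eq)
  bounds = ceiling-mkℚ n d cop
  above = ≤-*-of-same-/ same (ceiling q) (proj₂ bounds)
  below = ℤ.≰⇒> (λ i≤ → ℤ.<⇒≱ (proj₁ bounds) (≤-*-of-same-/ (sym same) (ℤ.pred (ceiling q)) i≤))

*-window-unique : ∀ {c v i} A → ℤ.pred c ℤ.* + A ℤ.< i → i ℤ.≤ c ℤ.* + A →
  ℤ.pred v ℤ.* + A ℤ.< i → i ℤ.≤ v ℤ.* + A → c ≡ v
*-window-unique {c} {v} A c₁ c₂ v₁ v₂ with ℤ.<-cmp c v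
... | tri≈ _ c≡v _ = c≡v
... | tri< c<v _ _ = ⊥-elim (ℤ.<⇒≱ v₁ (ℤ.≤-trans c₂ (ℤ.*-monoʳ-≤-nonNeg (+ A) (ℤ.i<j⇒i≤pred[j] c<v))))
... | tri> _ _ v<c = ⊥-elim (ℤ.<⇒≱ c₁ (ℤ.≤-trans v₂ (ℤ.*-monoʳ-≤-nonNeg (+ A) (ℤ.i<j⇒i≤pred[j] v<c))))

ceiling-/-unique : ∀ i a v → ℤ.pred v ℤ.* + suc a ℤ.< i → i ℤ.≤ v ℤ.* + suc a →
  ceiling (i ℚ./ suc a) ≡ v
ceiling-/-unique i a v v₁ v₂ = *-window-unique (suc a) (proj₁ bounds) (proj₂ bounds) v₁ v₂
  where bounds = ceiling-/ i a

-- Lecture hall partitions, one part at a time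

-- λ_m / m ≤ z / (m + 1) cross-multiplied, where the chain starts with 0 ≤ λ_1 when m = 0.
LectureHallStep : (m : ℕ) → Vec ℤ m → ℤ → Set
LectureHallStep zero    l z = + 0 ℤ.≤ z
LectureHallStep (suc m) l z = lookup l (fromℕ m) ℤ.* + suc (suc m) ℤ.≤ z ℤ.* + suc m

private
  ratio-∷ʳ-inject₁ : ∀ {m} (l : Vec ℤ m) z j → ratio (l ∷ʳ z) (inject₁ j) ≡ ratio l j
  ratio-∷ʳ-inject₁ l z j = ℚ./-cong (lookup-∷ʳ-inject₁ l z j) (cong suc (Fin.toℕ-inject₁ j))

  prevRatio-∷ʳ-inject₁ : ∀ {m} (l : Vec ℤ m) z j → prevRatio (l ∷ʳ z) (inject₁ j) ≡ prevRatio l j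
  prevRatio-∷ʳ-inject₁ l z zero    = refl
  prevRatio-∷ʳ-inject₁ l z (suc j) = ratio-∷ʳ-inject₁ l z (inject₁ j)

  ratio-∷ʳ-fromℕ : ∀ {m} (l : Vec ℤ m) z → ratio (l ∷ʳ z) (fromℕ m) ≡ z ℚ./ suc m
  ratio-∷ʳ-fromℕ {m} l z = ℚ./-cong (lookup-∷ʳ-fromℕ l z) (cong suc (Fin.toℕ-fromℕ m))

  lastStep⇔ : ∀ {m} (l : Vec ℤ m) z →
    (prevRatio (l ∷ʳ z) (fromℕ m) ℚ.≤ ratio (l ∷ʳ z) (fromℕ m)) ⇔ LectureHallStep m l z
  lastStep⇔ {zero} [] z = mk⇔
    (λ le → subst₂ ℤ._≤_ (ℤ.*-zeroˡ (+ 1)) (ℤ.*-identityʳ z) (Equivalence.to (/-≤-/ (+ 0) z 0 0) le))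
    (λ le → Equivalence.from (/-≤-/ (+ 0) z 0 0)
              (subst₂ ℤ._≤_ (sym (ℤ.*-zeroˡ (+ 1))) (sym (ℤ.*-identityʳ z)) le))
  lastStep⇔ {suc m} l z = mk⇔
    (λ le → Equivalence.to lhStep (subst₂ ℚ._≤_ prev≡ (ratio-∷ʳ-fromℕ l z) le))
    (λ le → subst₂ ℚ._≤_ (sym prev≡) (sym (ratio-∷ʳ-fromℕ l z)) (Equivalence.from lhStep le))
    where
    lhStep = /-≤-/ (lookup l (fromℕ m)) z m (suc m)
    prev≡ : prevRatio (l ∷ʳ z) (fromℕ (suc m)) ≡ lookup l (fromℕ m) ℚ./ suc m
    prev≡ = trans (ratio-∷ʳ-inject₁ l z (fromℕ m))
                  (ℚ./-cong {lookup l (fromℕ m)} refl (cong suc (Fin.toℕ-fromℕ m)))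

lectureHall-∷ʳ : ∀ {m} (l : Vec ℤ m) z →
  LectureHall (suc m) (l ∷ʳ z) ⇔ (LectureHall m l × LectureHallStep m l z)
lectureHall-∷ʳ {m} l z = mk⇔
  (λ lh → (λ j → subst₂ ℚ._≤_ (prevRatio-∷ʳ-inject₁ l z j) (ratio-∷ʳ-inject₁ l z j) (lh (inject₁ j)))
        , Equivalence.to (lastStep⇔ l z) (lh (fromℕ m)))
  (λ (lh , step) i → extend lh step i (view i))
  where
  extend : LectureHall m l → LectureHallStep m l z → ∀ i → View i → prevRatio (l ∷ʳ z) i ℚ.≤ ratio (l ∷ʳ z) i
  extend lh step _ ‵fromℕ        = Equivalence.from (lastStep⇔ l z) step
  extend lh step _ (‵inject₁ j) =
    subst₂ ℚ._≤_ (sym (prevRatio-∷ʳ-inject₁ l z j)) (sym (ratio-∷ʳ-inject₁ l z j)) (lh j)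

lectureHall-init : ∀ {m} (l : Vec ℤ (suc m)) → LectureHall (suc m) l →
  LectureHall m (init l) × LectureHallStep m (init l) (last l)
lectureHall-init l lh =
  Equivalence.to (lectureHall-∷ʳ (init l) (last l)) (subst (LectureHall _) (sym (init-∷ʳ-last l)) lh)

lectureHall-last-nonNeg : ∀ {m} (l : Vec ℤ (suc m)) → LectureHall (suc m) l → + 0 ℤ.≤ last l
lectureHall-last-nonNeg {zero}  l lh = proj₂ (lectureHall-init l lh)
lectureHall-last-nonNeg {suc m} l lh with lectureHall-init l lh
... | lh′ , step = nonNeg (ℤ.≤-trans (ℤ.*-monoʳ-≤-nonNeg (+ suc (suc m)) prev-nonNeg) step)
  where
  prev-nonNeg : + 0 ℤ.≤ lookup (init l) (fromℕ m)
  prev-nonNeg = subst (+ 0 ℤ.≤_)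
    (trans (sym (lookup-∷ʳ-fromℕ (init (init l)) _)) (cong (λ t → lookup t (fromℕ m)) (init-∷ʳ-last (init l))))
    (lectureHall-last-nonNeg (init l) lh′)
  nonNeg : ∀ {z} → + 0 ℤ.≤ z ℤ.* + suc m → + 0 ℤ.≤ z
  nonNeg {+ n}      _  = +≤+ z≤n
  nonNeg { -[1+ n ]} le = ⊥-elim (ℤ.≤⇒≯ le (ℤ.*-monoʳ-<-pos (+ suc m) (ℤ.-<+ {n} {0})))

-- Encoding integer vectors as lecture hall partitions

posBit : ℤ → ℕ
posBit (+ zero)  = 0
posBit +[1+ n ]  = 1
posBit -[1+ n ]  = 0

posBit≤1 : ∀ z → posBit z ≤ 1
posBit≤1 (+ zero)  = z≤n
posBit≤1 +[1+ n ]  = s≤s z≤n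
posBit≤1 -[1+ n ]  = z≤n

posBit≡1⇒1≤∣z∣ : ∀ z → posBit z ≡ 1 → 1 ≤ ∣ z ∣
posBit≡1⇒1≤∣z∣ +[1+ n ] _ = s≤s z≤n

1+m+1+m≡2*[1+m] : ∀ m → suc m + suc m ≡ 2 * suc m
1+m+1+m≡2*[1+m] m = cong (_+_ (suc m)) (sym (ℕ.+-identityʳ (suc m)))

b*n≤n : ∀ {b} n → b ≤ 1 → b * n ≤ n
b*n≤n n b≤1 = ℕ.≤-trans (ℕ.*-monoˡ-≤ n b≤1) (ℕ.≤-reflexive (ℕ.*-identityˡ n))

-- An entry z at position p of a vector of length m + 1 is recorded by its absolute value and
-- the digit p + [z > 0](m + 1) < 2(m + 1); the rank orders entries by absolute value, then
-- positive before non-positive, then by position.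
digit : ∀ {m} → Fin (suc m) → ℤ → ℕ
digit {m} p z = toℕ p + posBit z * suc m

digit< : ∀ {m} (p : Fin (suc m)) z → digit p z < 2 * suc m
digit< {m} p z = subst (digit p z <_) (1+m+1+m≡2*[1+m] m)
  (ℕ.+-mono-<-≤ (Fin.toℕ<n p) (b*n≤n (suc m) (posBit≤1 z)))

rank : ∀ {m} → Vec ℤ (suc m) → Fin (suc m) → ℕ
rank {m} x p = ∣ lookup x p ∣ * (2 * suc m) + digit p (lookup x p)

top : ∀ {m} → Vec ℤ (suc m) → Fin (suc m)
top x = argmax (rank x)

topAbs : ∀ {m} → Vec ℤ (suc m) → ℕ
topAbs x = ∣ lookup x (top x) ∣

topDigit : ∀ {m} → Vec ℤ (suc m) → ℕ
topDigit x = digit (top x) (lookup x (top x))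

topDigit< : ∀ {m} (x : Vec ℤ (suc m)) → topDigit x < 2 * suc m
topDigit< x = digit< (top x) (lookup x (top x))

dropTop : ∀ {m} → Vec ℤ (suc m) → Vec ℤ m
dropTop x = removeAt x (top x)

-- Chosen so that ⌈part m v o / 2(m + 1)⌉ = v for every digit o.
part : ℕ → ℕ → ℕ → ℕ
part m zero    o = 0
part m (suc v) o = suc (v * (2 * suc m) + o)

encode : ∀ {m} → Vec ℤ m → Vec ℤ m
encode {zero}  x = []
encode {suc m} x = encode (dropTop x) ∷ʳ + part m (topAbs x) (topDigit x)

-- The part 0 decodes to a zero entry at the last position: that is where `top` finds the maximum
-- of a zero vector.
partAbs : ℕ → ℕ → ℕ
partAbs m zero    = 0
partAbs m (suc n) = suc (n / (2 * suc m))

partDigit : ℕ → ℕ → ℕ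
partDigit m zero    = m
partDigit m (suc n) = n % (2 * suc m)

partDigit< : ∀ m n → partDigit m n < 2 * suc m
partDigit< m zero    = ℕ.≤-trans (ℕ.n<1+n m) (ℕ.m≤m+n (suc m) _)
partDigit< m (suc n) = ℕ.m%n<n n (2 * suc m)

private
  ∸1+m<1+m : ∀ {m o} → o < 2 * suc m → ¬ o < suc m → o ∸ suc m < suc m
  ∸1+m<1+m {m} {o} o<2[1+m] o≮1+m = ℕ.+-cancelˡ-< (suc m) _ _
    (subst (_< suc m + suc m) (sym (ℕ.m+[n∸m]≡n (ℕ.≮⇒≥ o≮1+m)))
      (subst (o <_) (sym (1+m+1+m≡2*[1+m] m)) o<2[1+m]))

entryOfDigit : (m v o : ℕ) → .(o < 2 * suc m) → Fin (suc m) × ℤ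
entryOfDigit m v o o<2[1+m] with o ℕ.<? suc m
... | yes o<1+m = fromℕ< o<1+m , - + v
... | no  o≮1+m = fromℕ< (∸1+m<1+m o<2[1+m] o≮1+m) , + v

entryOfPart : (m n : ℕ) → Fin (suc m) × ℤ
entryOfPart m n = entryOfDigit m (partAbs m n) (partDigit m n) (partDigit< m n)

insertEntry : ∀ {m} → Vec ℤ m → Fin (suc m) × ℤ → Vec ℤ (suc m)
insertEntry x (p , z) = insertAt x p z

decode : ∀ {m} → Vec ℤ m → Vec ℤ m
decode {zero}  l = []
decode {suc m} l = insertEntry (decode (init l)) (entryOfPart m ∣ last l ∣)

decode-∷ʳ : ∀ {m} (l : Vec ℤ m) z → decode (l ∷ʳ z) ≡ insertEntry (decode l) (entryOfPart m ∣ z ∣)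
decode-∷ʳ l z rewrite Vec.init-∷ʳ z l | Vec.last-∷ʳ z l = refl

part-partAbs-partDigit : ∀ m n → part m (partAbs m n) (partDigit m n) ≡ n
part-partAbs-partDigit m zero    = refl
part-partAbs-partDigit m (suc n) =
  cong suc (trans (ℕ.+-comm _ (n % (2 * suc m))) (sym (ℕ.m≡m%n+[m/n]*n n (2 * suc m))))

partAbs-partDigit-part : ∀ m v o → o < 2 * suc m → (v ≡ 0 → o ≡ m) →
  partAbs m (part m v o) ≡ v × partDigit m (part m v o) ≡ o
partAbs-partDigit-part m zero    o o< v≡0⇒o≡m = refl , sym (v≡0⇒o≡m refl)
partAbs-partDigit-part m (suc v) o o< _ = map₁ (cong suc) (radix-/-% (2 * suc m) v o<)

partAbs≡0⇒partDigit≡m : ∀ m n → partAbs m n ≡ 0 → partDigit m n ≡ m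
partAbs≡0⇒partDigit≡m m zero _ = refl

entryOfDigit-cong : ∀ m {v v′ o o′} .(o< : o < 2 * suc m) .(o′< : o′ < 2 * suc m) → v ≡ v′ → o ≡ o′ →
  entryOfDigit m v o o< ≡ entryOfDigit m v′ o′ o′<
entryOfDigit-cong m _ _ refl refl = refl

entryOfDigit-abs-digit : ∀ m v o .(o< : o < 2 * suc m) → (v ≡ 0 → o ≡ m) →
  let (p , z) = entryOfDigit m v o o< in ∣ z ∣ ≡ v × digit p z ≡ o
entryOfDigit-abs-digit m v o o< v≡0⇒o≡m with o ℕ.<? suc m
entryOfDigit-abs-digit m zero    o o< _ | yes o<1+m = refl , trans (ℕ.+-identityʳ _) (Fin.toℕ-fromℕ< o<1+m)
entryOfDigit-abs-digit m (suc v) o o< _ | yes o<1+m = refl , trans (ℕ.+-identityʳ _) (Fin.toℕ-fromℕ< o<1+m)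
entryOfDigit-abs-digit m zero    o o< v≡0⇒o≡m | no o≮1+m =
  ⊥-elim (o≮1+m (subst (_< suc m) (sym (v≡0⇒o≡m refl)) (ℕ.n<1+n m)))
entryOfDigit-abs-digit m (suc v) o o< _ | no o≮1+m = refl , (begin
  toℕ (fromℕ< _) + (suc m + 0)  ≡⟨ cong₂ _+_ (Fin.toℕ-fromℕ< _) (ℕ.+-identityʳ (suc m)) ⟩
  o ∸ suc m + suc m             ≡⟨ ℕ.m∸n+n≡m (ℕ.≮⇒≥ o≮1+m) ⟩
  o                             ∎)
  where open ≡-Reasoning

entryOfDigit-digit : ∀ m z (p : Fin (suc m)) .(o< : digit p z < 2 * suc m) →
  entryOfDigit m ∣ z ∣ (digit p z) o< ≡ (p , z)
entryOfDigit-digit m (+ zero) p o< with toℕ p + 0 ℕ.<? suc m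
... | yes p<1+m = cong₂ _,_ (Fin.toℕ-injective (trans (Fin.toℕ-fromℕ< p<1+m) (ℕ.+-identityʳ _))) refl
... | no  p≮1+m = ⊥-elim (p≮1+m (subst (_< suc m) (sym (ℕ.+-identityʳ _)) (Fin.toℕ<n p)))
entryOfDigit-digit m -[1+ n ] p o< with toℕ p + 0 ℕ.<? suc m
... | yes p<1+m = cong₂ _,_ (Fin.toℕ-injective (trans (Fin.toℕ-fromℕ< p<1+m) (ℕ.+-identityʳ _))) refl
... | no  p≮1+m = ⊥-elim (p≮1+m (subst (_< suc m) (sym (ℕ.+-identityʳ _)) (Fin.toℕ<n p)))
entryOfDigit-digit m +[1+ n ] p o< with toℕ p + (suc m + 0) ℕ.<? suc m
... | yes p+1+m<1+m = ⊥-elim (ℕ.<⇒≱ p+1+m<1+m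
                        (ℕ.≤-trans (ℕ.≤-reflexive (sym (ℕ.+-identityʳ _))) (ℕ.m≤n+m _ (toℕ p))))
... | no  _         = cong₂ _,_ (Fin.toℕ-injective (begin
  toℕ (fromℕ< _)               ≡⟨ Fin.toℕ-fromℕ< _ ⟩
  toℕ p + (suc m + 0) ∸ suc m  ≡⟨ cong (λ t → toℕ p + t ∸ suc m) (ℕ.+-identityʳ (suc m)) ⟩
  toℕ p + suc m ∸ suc m        ≡⟨ ℕ.m+n∸n≡m (toℕ p) (suc m) ⟩
  toℕ p                        ∎)) refl
  where open ≡-Reasoning

PositionOfDigit : (N o g : ℕ) → Set
PositionOfDigit N o g = (o < N × g ≡ o) ⊎ (N ≤ o × g ≡ o ∸ N)

entryOfDigit-position : ∀ m v o .(o< : o < 2 * suc m) →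
  PositionOfDigit (suc m) o (toℕ (proj₁ (entryOfDigit m v o o<)))
entryOfDigit-position m v o o< with o ℕ.<? suc m
... | yes o<1+m = inj₁ (o<1+m , Fin.toℕ-fromℕ< o<1+m)
... | no  o≮1+m = inj₂ (ℕ.≮⇒≥ o≮1+m , Fin.toℕ-fromℕ< _)

entryOfPart-abs-digit : ∀ m k → let (g , y) = entryOfPart m k in ∣ y ∣ ≡ partAbs m k × digit g y ≡ partDigit m k
entryOfPart-abs-digit m k =
  entryOfDigit-abs-digit m (partAbs m k) (partDigit m k) (partDigit< m k) (partAbs≡0⇒partDigit≡m m k)

part-entryOfPart : ∀ m k → let (g , y) = entryOfPart m k in part m ∣ y ∣ (digit g y) ≡ k
part-entryOfPart m k =
  trans (cong₂ (part m) (proj₁ (entryOfPart-abs-digit m k)) (proj₂ (entryOfPart-abs-digit m k)))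
        (part-partAbs-partDigit m k)

rank-injective : ∀ {m} (x : Vec ℤ (suc m)) {p q} → rank x p ≡ rank x q → p ≡ q
rank-injective {m} x {p} {q} eq = Fin.toℕ-injective
  (radix-injectiveʳ (suc m) (posBit (lookup x p)) (posBit (lookup x q)) (Fin.toℕ<n p) (Fin.toℕ<n q)
    (trans (ℕ.+-comm _ (toℕ p)) (trans digit≡ (ℕ.+-comm (toℕ q) _))))
  where
  digit≡ : digit p (lookup x p) ≡ digit q (lookup x q)
  digit≡ = radix-injectiveʳ (2 * suc m) ∣ lookup x p ∣ ∣ lookup x q ∣
             (digit< p (lookup x p)) (digit< q (lookup x q)) eq

rank<rank[top] : ∀ {m} (x : Vec ℤ (suc m)) {p} → p ≢ top x → rank x p < rank x (top x)
rank<rank[top] x {p} p≢top = ℕ.≤∧≢⇒< (f≤f[argmax] (rank x) p) (p≢top ∘ rank-injective x)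

∣lookup∣≤topAbs : ∀ {m} (x : Vec ℤ (suc m)) p → ∣ lookup x p ∣ ≤ topAbs x
∣lookup∣≤topAbs {m} x p = radix-cancel-≤ (2 * suc m) ∣ lookup x p ∣ (topAbs x) (topDigit< x) (f≤f[argmax] (rank x) p)

top-dominant : ∀ {m} (x : Vec ℤ (suc m)) g → (∀ p → rank x (punchIn g p) < rank x g) → top x ≡ g
top-dominant x g dominant with top x Fin.≟ g
... | yes top≡g = top≡g
... | no  top≢g = ⊥-elim (ℕ.<⇒≱ (subst (λ p → rank x p < rank x g) (Fin.punchIn-punchOut g≢top)
                                    (dominant (punchOut g≢top)))
                                  (f≤f[argmax] (rank x) g))
  where
  g≢top : g ≢ top x
  g≢top = top≢g ∘ sym

private
  top≡0⇒m≤toℕ[top] : ∀ {m} (x : Vec ℤ (suc m)) → lookup x (top x) ≡ + 0 → m ≤ toℕ (top x)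
  top≡0⇒m≤toℕ[top] {m} x top≡0 = begin
    m                               ≡⟨ Fin.toℕ-fromℕ m ⟨
    toℕ (fromℕ m)                   ≤⟨ ℕ.m≤m+n _ _ ⟩
    digit (fromℕ m) (lookup x _)    ≤⟨ ℕ.m≤n+m _ (∣ lookup x (fromℕ m) ∣ * _) ⟩
    rank x (fromℕ m)                ≤⟨ f≤f[argmax] (rank x) (fromℕ m) ⟩
    rank x (top x)                  ≡⟨ cong (λ z → ∣ z ∣ * _ + digit (top x) z) top≡0 ⟩
    toℕ (top x) + 0                 ≡⟨ ℕ.+-identityʳ _ ⟩
    toℕ (top x)                     ∎
    where open ℕ.≤-Reasoning

topAbs≡0⇒topDigit≡m : ∀ {m} (x : Vec ℤ (suc m)) → topAbs x ≡ 0 → topDigit x ≡ m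
topAbs≡0⇒topDigit≡m {m} x topAbs≡0 = begin
  toℕ (top x) + posBit (lookup x (top x)) * suc m
    ≡⟨ cong (λ z → toℕ (top x) + posBit z * suc m) top≡0 ⟩
  toℕ (top x) + 0
    ≡⟨ ℕ.+-identityʳ _ ⟩
  toℕ (top x)
    ≡⟨ ℕ.≤-antisym (ℕ.s≤s⁻¹ (Fin.toℕ<n (top x))) (top≡0⇒m≤toℕ[top] x top≡0) ⟩
  m ∎
  where
  open ≡-Reasoning
  top≡0 : lookup x (top x) ≡ + 0
  top≡0 = ℤ.∣i∣≡0⇒i≡0 topAbs≡0

entryOfPart-top : ∀ {m} (x : Vec ℤ (suc m)) →
  entryOfPart m (part m (topAbs x) (topDigit x)) ≡ (top x , lookup x (top x))
entryOfPart-top {m} x = trans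
  (entryOfDigit-cong m _ (topDigit< x) (proj₁ decoded) (proj₂ decoded))
  (entryOfDigit-digit m (lookup x (top x)) (top x) (topDigit< x))
  where decoded = partAbs-partDigit-part m (topAbs x) (topDigit x) (topDigit< x) (topAbs≡0⇒topDigit≡m x)

decode-encode : ∀ {m} (x : Vec ℤ m) → decode (encode x) ≡ x
decode-encode {zero}  [] = refl
decode-encode {suc m} x = begin
  decode (encode (dropTop x) ∷ʳ + part m (topAbs x) (topDigit x))
    ≡⟨ decode-∷ʳ (encode (dropTop x)) _ ⟩
  insertEntry (decode (encode (dropTop x))) (entryOfPart m (part m (topAbs x) (topDigit x)))
    ≡⟨ cong₂ insertEntry (decode-encode (dropTop x)) (entryOfPart-top x) ⟩
  insertAt (removeAt x (top x)) (top x) (lookup x (top x))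
    ≡⟨ Vec.insertAt-removeAt x (top x) ⟩
  x ∎
  where open ≡-Reasoning

-- Sorted sums and the rearrangement inequality

-- Σ α_i |x|_(i), with the absolute values of the entries in increasing order.
sortedSum : ∀ {m} → (Fin m → ℤ) → Vec ℤ m → ℤ
sortedSum {zero}  α x = + 0
sortedSum {suc m} α x = sortedSum (α ∘ inject₁) (dropTop x) ℤ.+ α (fromℕ m) ℤ.* + topAbs x

permutedSum : ∀ {m} → (Fin m → ℤ) → Permutation′ m → Vec ℤ m → ℤ
permutedSum α π x = sumℤ (λ i → α i ℤ.* + ∣ lookup x (π ⟨$⟩ʳ i) ∣)

sortedSum-cong : ∀ {m} {α β : Fin m → ℤ} (x : Vec ℤ m) → (∀ i → α i ≡ β i) → sortedSum α x ≡ sortedSum β x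
sortedSum-cong {zero}  x eq = refl
sortedSum-cong {suc m} x eq =
  cong₂ ℤ._+_ (sortedSum-cong (dropTop x) (eq ∘ inject₁)) (cong (ℤ._* + topAbs x) (eq (fromℕ m)))

∣lookup-dropTop∣≤topAbs : ∀ {m} (x : Vec ℤ (suc m)) p → ∣ lookup (dropTop x) p ∣ ≤ topAbs x
∣lookup-dropTop∣≤topAbs x p =
  subst (λ z → ∣ z ∣ ≤ topAbs x) (sym (lookup-removeAt x (top x) p)) (∣lookup∣≤topAbs x _)

private
  +-cancelʳ-≤ : ∀ i j k → i ℤ.+ k ℤ.≤ j ℤ.+ k → i ℤ.≤ j
  +-cancelʳ-≤ i j k le = subst₂ ℤ._≤_ (ring i k) (ring j k) (ℤ.+-monoˡ-≤ (- k) le)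
    where
    ring : ∀ i k → i ℤ.+ k ℤ.- k ≡ i
    ring = ℤ-solve

  *-nonNeg : ∀ {i j} → + 0 ℤ.≤ i → + 0 ℤ.≤ j → + 0 ℤ.≤ i ℤ.* j
  *-nonNeg {+ i} {+ j} _ _ = subst (+ 0 ℤ.≤_) (ℤ.pos-* i j) (+≤+ z≤n)

rearrangement₂ : ∀ {a b u v} → a ℤ.≤ b → u ℤ.≤ v → a ℤ.* v ℤ.+ b ℤ.* u ℤ.≤ b ℤ.* v ℤ.+ a ℤ.* u
rearrangement₂ {a} {b} {u} {v} a≤b u≤v = subst₂ ℤ._≤_ (ring₁ a b u v) (ring₂ a b u v)
  (ℤ.+-monoʳ-≤ (a ℤ.* v ℤ.+ b ℤ.* u) (*-nonNeg (ℤ.i≤j⇒0≤j-i a≤b) (ℤ.i≤j⇒0≤j-i u≤v)))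
  where
  ring₁ : ∀ a b u v → a ℤ.* v ℤ.+ b ℤ.* u ℤ.+ + 0 ≡ a ℤ.* v ℤ.+ b ℤ.* u
  ring₁ = ℤ-solve
  ring₂ : ∀ a b u v → a ℤ.* v ℤ.+ b ℤ.* u ℤ.+ (b ℤ.- a) ℤ.* (v ℤ.- u) ≡ b ℤ.* v ℤ.+ a ℤ.* u
  ring₂ = ℤ-solve

Monotone : ∀ {m} → (Fin m → ℤ) → Set
Monotone α = α Preserves Fin._≤_ ⟶ ℤ._≤_

monotone-inject₁ : ∀ {m} {α : Fin (suc m) → ℤ} → Monotone α → Monotone (α ∘ inject₁)
monotone-inject₁ mono {i} {j} i≤j =
  mono (subst₂ _≤_ (sym (Fin.toℕ-inject₁ i)) (sym (Fin.toℕ-inject₁ j)) i≤j)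

monotone-punchIn : ∀ {m} {α : Fin (suc m) → ℤ} j → Monotone α → Monotone (α ∘ punchIn j)
monotone-punchIn j mono {i} {k} i≤k = mono (Fin.punchIn-mono-≤ j i k i≤k)

-- Pairing the largest absolute value V with the largest coefficient rather than with α j is better.
sortedSum-exchange : ∀ {m} (α : Fin (suc m) → ℤ) → Monotone α → ∀ j (x : Vec ℤ m) V →
  (∀ p → ∣ lookup x p ∣ ≤ V) →
  α j ℤ.* + V ℤ.+ sortedSum (α ∘ punchIn j) x ℤ.≤ α (fromℕ m) ℤ.* + V ℤ.+ sortedSum (α ∘ inject₁) x
sortedSum-exchange {zero}  α mono zero [] V _ = ℤ.≤-refl
sortedSum-exchange {suc m} α mono j x V x≤V with view j
... | ‵fromℕ = ℤ.≤-reflexive (cong (ℤ._+_ (α (fromℕ (suc m)) ℤ.* + V))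
                 (sortedSum-cong x (cong α ∘ punchIn-fromℕ)))
... | ‵inject₁ j′ = begin
  α (inject₁ j′) ℤ.* + V ℤ.+ sortedSum (α ∘ punchIn (inject₁ j′)) x
    ≡⟨ cong (ℤ._+_ (α (inject₁ j′) ℤ.* + V)) peel ⟩
  α (inject₁ j′) ℤ.* + V ℤ.+ (P ℤ.+ α (fromℕ (suc m)) ℤ.* + u)
    ≤⟨ combine (α (inject₁ j′)) (α (fromℕ (suc m))) (α′ (fromℕ m)) (+ u) (+ V) P R ih
         (rearrangement₂ (mono (Fin.≤fromℕ (inject₁ j′))) (+≤+ (x≤V (top x)))) ⟩
  α (fromℕ (suc m)) ℤ.* + V ℤ.+ (R ℤ.+ α′ (fromℕ m) ℤ.* + u)
    ∎
  where
  open ℤ.≤-Reasoning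
  α′ = α ∘ inject₁
  u  = topAbs x
  P  = sortedSum (α′ ∘ punchIn j′) (dropTop x)
  R  = sortedSum (α′ ∘ inject₁) (dropTop x)
  ih : α′ j′ ℤ.* + u ℤ.+ P ℤ.≤ α′ (fromℕ m) ℤ.* + u ℤ.+ R
  ih = sortedSum-exchange α′ (monotone-inject₁ mono) j′ (dropTop x) u (∣lookup-dropTop∣≤topAbs x)
  peel : sortedSum (α ∘ punchIn (inject₁ j′)) x ≡ P ℤ.+ α (fromℕ (suc m)) ℤ.* + u
  peel = cong₂ ℤ._+_ (sortedSum-cong (dropTop x) (cong α ∘ punchIn-inject₁ j′))
                     (cong (λ i → α i ℤ.* + u) (punchIn-inject₁-fromℕ j′))
  combine : ∀ a b c u v P R → a ℤ.* u ℤ.+ P ℤ.≤ c ℤ.* u ℤ.+ R →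
    a ℤ.* v ℤ.+ b ℤ.* u ℤ.≤ b ℤ.* v ℤ.+ a ℤ.* u →
    a ℤ.* v ℤ.+ (P ℤ.+ b ℤ.* u) ℤ.≤ b ℤ.* v ℤ.+ (R ℤ.+ c ℤ.* u)
  combine a b c u v P R le₁ le₂ = +-cancelʳ-≤ _ _ (a ℤ.* u)
    (subst₂ ℤ._≤_ (ring₁ a b c u v P R) (ring₂ a b c u v P R) (ℤ.+-mono-≤ le₁ le₂))
    where
    ring₁ : ∀ a b c u v P R →
      a ℤ.* u ℤ.+ P ℤ.+ (a ℤ.* v ℤ.+ b ℤ.* u) ≡ a ℤ.* v ℤ.+ (P ℤ.+ b ℤ.* u) ℤ.+ a ℤ.* u
    ring₁ = ℤ-solve
    ring₂ : ∀ a b c u v P R →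
      c ℤ.* u ℤ.+ R ℤ.+ (b ℤ.* v ℤ.+ a ℤ.* u) ≡ b ℤ.* v ℤ.+ (R ℤ.+ c ℤ.* u) ℤ.+ a ℤ.* u
    ring₂ = ℤ-solve

permutedSum≤sortedSum : ∀ {m} (α : Fin m → ℤ) → Monotone α → ∀ π (x : Vec ℤ m) →
  permutedSum α π x ℤ.≤ sortedSum α x
permutedSum≤sortedSum {zero}  α mono π x = ℤ.≤-refl
permutedSum≤sortedSum {suc m} α mono π x = begin
  permutedSum α π x
    ≡⟨ sumℤ-punchIn f j ⟩
  f j ℤ.+ sumℤ (f ∘ punchIn j)
    ≡⟨ cong₂ ℤ._+_ fj≡ (sumℤ-cong f∘punchIn≡) ⟩
  α j ℤ.* + topAbs x ℤ.+ permutedSum (α ∘ punchIn j) π′ (dropTop x)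
    ≤⟨ ℤ.+-monoʳ-≤ (α j ℤ.* + topAbs x)
         (permutedSum≤sortedSum (α ∘ punchIn j) (monotone-punchIn j mono) π′ (dropTop x)) ⟩
  α j ℤ.* + topAbs x ℤ.+ sortedSum (α ∘ punchIn j) (dropTop x)
    ≤⟨ sortedSum-exchange α mono j (dropTop x) (topAbs x) (∣lookup-dropTop∣≤topAbs x) ⟩
  α (fromℕ m) ℤ.* + topAbs x ℤ.+ sortedSum (α ∘ inject₁) (dropTop x)
    ≡⟨ ℤ.+-comm (α (fromℕ m) ℤ.* + topAbs x) _ ⟩
  sortedSum α x
    ∎
  where
  open ℤ.≤-Reasoning
  j  = π ⟨$⟩ˡ top x
  π′ = Perm.remove j π
  f : Fin (suc m) → ℤ
  f i = α i ℤ.* + ∣ lookup x (π ⟨$⟩ʳ i) ∣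
  fj≡ : f j ≡ α j ℤ.* + topAbs x
  fj≡ = cong (λ p → α j ℤ.* + ∣ lookup x p ∣) (Perm.inverseʳ π)
  f∘punchIn≡ : ∀ i → f (punchIn j i) ≡ α (punchIn j i) ℤ.* + ∣ lookup (dropTop x) (π′ ⟨$⟩ʳ i) ∣
  f∘punchIn≡ i = cong (λ z → α (punchIn j i) ℤ.* + ∣ z ∣) (begin-equality
    lookup x (π ⟨$⟩ʳ punchIn j i)
      ≡⟨ cong (lookup x) (Perm.punchIn-permute π j i) ⟩
    lookup x (punchIn (π ⟨$⟩ʳ j) (π′ ⟨$⟩ʳ i))
      ≡⟨ cong (λ p → lookup x (punchIn p (π′ ⟨$⟩ʳ i))) (Perm.inverseʳ π) ⟩
    lookup x (punchIn (top x) (π′ ⟨$⟩ʳ i))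
      ≡⟨ lookup-removeAt x (top x) (π′ ⟨$⟩ʳ i) ⟨
    lookup (dropTop x) (π′ ⟨$⟩ʳ i)
      ∎)

sortedSum-attained : ∀ {m} (α : Fin m → ℤ) (x : Vec ℤ m) →
  Σ (Permutation′ m) λ π → permutedSum α π x ≡ sortedSum α x
sortedSum-attained {zero}  α x = Perm.id , refl
sortedSum-attained {suc m} α x = π , (begin
  sumℤ f                              ≡⟨ sumℤ-fromℕ f ⟩
  sumℤ (f ∘ inject₁) ℤ.+ f (fromℕ m)  ≡⟨ cong₂ ℤ._+_ (trans (sumℤ-cong f∘inject₁≡) π′-attains) f-last≡ ⟩
  sortedSum α x                       ∎)
  where
  open ≡-Reasoning
  π′ = proj₁ (sortedSum-attained (α ∘ inject₁) (dropTop x))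
  π′-attains = proj₂ (sortedSum-attained (α ∘ inject₁) (dropTop x))
  π = Perm.insert (fromℕ m) (top x) π′
  f : Fin (suc m) → ℤ
  f i = α i ℤ.* + ∣ lookup x (π ⟨$⟩ʳ i) ∣
  π-fromℕ : π ⟨$⟩ʳ fromℕ m ≡ top x
  π-fromℕ with fromℕ m Fin.≟ fromℕ m
  ... | yes _    = refl
  ... | no  m≢m  = ⊥-elim (m≢m refl)
  f-last≡ : f (fromℕ m) ≡ α (fromℕ m) ℤ.* + topAbs x
  f-last≡ = cong (λ p → α (fromℕ m) ℤ.* + ∣ lookup x p ∣) π-fromℕ
  f∘inject₁≡ : ∀ i → f (inject₁ i) ≡ α (inject₁ i) ℤ.* + ∣ lookup (dropTop x) (π′ ⟨$⟩ʳ i) ∣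
  f∘inject₁≡ i = cong (λ z → α (inject₁ i) ℤ.* + ∣ z ∣) (begin
    lookup x (π ⟨$⟩ʳ inject₁ i)                  ≡⟨ cong (λ p → lookup x (π ⟨$⟩ʳ p)) (punchIn-fromℕ i) ⟨
    lookup x (π ⟨$⟩ʳ punchIn (fromℕ m) i)        ≡⟨ cong (lookup x) (Perm.insert-punchIn (fromℕ m) (top x) π′ i) ⟩
    lookup x (punchIn (top x) (π′ ⟨$⟩ʳ i))       ≡⟨ lookup-removeAt x (top x) (π′ ⟨$⟩ʳ i) ⟨
    lookup (dropTop x) (π′ ⟨$⟩ʳ i)               ∎)

-- The lecture hall inequality between the last two parts

part≤abs* : ∀ n v {o} → o < 2 * suc n → part n v o ≤ v * (2 * suc n)
part≤abs* n zero    o<D = z≤n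
part≤abs* n (suc w) {o} o<D =
  subst (suc (w * (2 * suc n) + o) ≤_) (ℕ.+-comm (w * (2 * suc n)) (2 * suc n)) (ℕ.+-monoʳ-< (w * (2 * suc n)) o<D)

-- For λ′ = part n v′ o′ and λ = part (n + 1) v o, the lecture hall inequality λ′/(n + 1) ≤ λ/(n + 2)
-- compares v′ ≤ v first and, when v′ = v ≥ 1, the fractions (o′ + 1)/(n + 1) ≤ (o + 1)/(n + 2).
part-ratio-suc : ∀ n w o′ o →
  part n (suc w) o′ * suc (suc n) ≤ part (suc n) (suc w) o * suc n ⇔ suc o′ * suc (suc n) ≤ suc o * suc n
part-ratio-suc n w o′ o = mk⇔
  (λ le → ℕ.+-cancelˡ-≤ (w * (2 * suc (suc n)) * suc n) _ _ (subst₂ _≤_ (lhs≡ n w o′) (rhs≡ n w o) le))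
  (λ le → subst₂ _≤_ (sym (lhs≡ n w o′)) (sym (rhs≡ n w o)) (ℕ.+-monoʳ-≤ (w * (2 * suc (suc n)) * suc n) le))
  where
  lhs≡ : ∀ n w o′ →
    suc (w * (2 * suc n) + o′) * suc (suc n) ≡ w * (2 * suc (suc n)) * suc n + suc o′ * suc (suc n)
  lhs≡ = ℕ-solve
  rhs≡ : ∀ n w o → suc (w * (2 * suc (suc n)) + o) * suc n ≡ w * (2 * suc (suc n)) * suc n + suc o * suc n
  rhs≡ = ℕ-solve

part-ratio-of-< : ∀ n {A v} o′ o → A < v → o′ < 2 * suc n →
  part n A o′ * suc (suc n) ≤ part (suc n) v o * suc n
part-ratio-of-< n {zero}   o′ o A<v o′<D′ = z≤n
part-ratio-of-< n {suc A} {suc v} o′ o (s≤s A<v) o′<D′ = begin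
  suc (A * D′ + o′) * suc (suc n)  ≤⟨ ℕ.*-monoˡ-≤ (suc (suc n)) (part≤abs* n (suc A) o′<D′) ⟩
  suc A * D′ * suc (suc n)         ≡⟨ ring n (suc A) ⟩
  suc A * D * suc n                ≤⟨ ℕ.*-monoˡ-≤ (suc n) (ℕ.*-monoˡ-≤ D A<v) ⟩
  v * D * suc n                    ≤⟨ ℕ.*-monoˡ-≤ (suc n) (ℕ.≤-trans (ℕ.m≤m+n (v * D) o) (ℕ.n≤1+n _)) ⟩
  suc (v * D + o) * suc n          ∎
  where
  open ℕ.≤-Reasoning
  D′ = 2 * suc n
  D  = 2 * suc (suc n)
  ring : ∀ n a → a * (2 * suc n) * suc (suc n) ≡ a * (2 * suc (suc n)) * suc n
  ring = ℕ-solve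

abs≤abs-of-part-ratio : ∀ n {v′ o′ v o} → o < 2 * suc (suc n) →
  part n v′ o′ * suc (suc n) ≤ part (suc n) v o * suc n → v′ ≤ v
abs≤abs-of-part-ratio n {v′} {o′} {v} {o} o<D le with v′ ℕ.≤? v
... | yes v′≤v = v′≤v
... | no  v′≰v = ⊥-elim (ℕ.<⇒≱ (too-big v′ (ℕ.≰⇒> v′≰v)) le)
  where
  too-big : ∀ v′ → v < v′ → part (suc n) v o * suc n < part n v′ o′ * suc (suc n)
  too-big (suc w) (s≤s v≤w) = begin-strict
    part (suc n) v o * suc n              ≤⟨ ℕ.*-monoˡ-≤ (suc n) (part≤abs* (suc n) v o<D) ⟩
    v * (2 * suc (suc n)) * suc n         ≡⟨ ring n v ⟩
    v * (2 * suc n) * suc (suc n)         ≤⟨ ℕ.*-monoˡ-≤ (suc (suc n)) (ℕ.*-monoˡ-≤ (2 * suc n) v≤w) ⟩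
    w * (2 * suc n) * suc (suc n)         <⟨ ℕ.*-monoˡ-< (suc (suc n)) (s≤s (ℕ.m≤m+n (w * (2 * suc n)) o′)) ⟩
    suc (w * (2 * suc n) + o′) * suc (suc n) ∎
    where
    open ℕ.≤-Reasoning
    ring : ∀ n a → a * (2 * suc (suc n)) * suc n ≡ a * (2 * suc n) * suc (suc n)
    ring = ℕ-solve

digit-ratio-≤ : ∀ n {p q s o} → p < suc n → p ≤ q → q + s * suc (suc n) < o →
  suc (p + s * suc n) * suc (suc n) ≤ suc o * suc n
digit-ratio-≤ n {p} {q} {s} {o} p<m p≤q qs<o = begin
  suc (p + s * suc n) * suc (suc n)
    ≡⟨ ring₁ n p s ⟩
  suc (p + s * suc n) * suc n + suc (p + s * suc n)
    ≤⟨ ℕ.+-monoʳ-≤ (suc (p + s * suc n) * suc n) (ℕ.+-monoˡ-≤ (s * suc n) p<m) ⟩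
  suc (p + s * suc n) * suc n + (suc n + s * suc n)
    ≡⟨ ring₂ n p s ⟩
  suc (suc (p + s * suc (suc n))) * suc n
    ≤⟨ ℕ.*-monoˡ-≤ (suc n) (s≤s (ℕ.≤-<-trans (ℕ.+-monoˡ-≤ _ p≤q) qs<o)) ⟩
  suc o * suc n
    ∎
  where
  open ℕ.≤-Reasoning
  ring₁ : ∀ n p s → suc (p + s * suc n) * suc (suc n) ≡ suc (p + s * suc n) * suc n + suc (p + s * suc n)
  ring₁ = ℕ-solve
  ring₂ : ∀ n p s → suc (p + s * suc n) * suc n + (suc n + s * suc n) ≡ suc (suc (p + s * suc (suc n))) * suc n
  ring₂ = ℕ-solve

digit<digit-of-ratio : ∀ n {o′ o} → suc o′ * suc (suc n) ≤ suc o * suc n → o′ < o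
digit<digit-of-ratio n {o′} {o} le with o′ ℕ.<? o
... | yes o′<o = o′<o
... | no  o′≮o = ⊥-elim (ℕ.<⇒≱ (begin-strict
  suc o * suc n                  ≤⟨ ℕ.*-monoˡ-≤ (suc n) (s≤s (ℕ.≮⇒≥ o′≮o)) ⟩
  suc o′ * suc n                 <⟨ ℕ.m<m+n (suc o′ * suc n) (s≤s z≤n) ⟩
  suc o′ * suc n + suc o′        ≡⟨ ring n o′ ⟩
  suc o′ * suc (suc n)           ∎) le)
  where
  open ℕ.≤-Reasoning
  ring : ∀ n o′ → suc o′ * suc n + suc o′ ≡ suc o′ * suc (suc n)
  ring = ℕ-solve

suc-digit<digit-of-ratio : ∀ n {o′ o} → suc n ≤ o′ → suc o′ * suc (suc n) ≤ suc o * suc n → suc o′ < o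
suc-digit<digit-of-ratio n {o′} {o} m≤o′ le with suc o′ ℕ.<? o
... | yes o′<o = o′<o
... | no  o′≮o = ⊥-elim (ℕ.<⇒≱ (begin-strict
  suc o * suc n                  ≤⟨ ℕ.*-monoˡ-≤ (suc n) (s≤s (ℕ.≮⇒≥ o′≮o)) ⟩
  suc (suc o′) * suc n           ≡⟨ ring₁ n o′ ⟩
  suc o′ * suc n + suc n         ≤⟨ ℕ.+-monoʳ-≤ (suc o′ * suc n) m≤o′ ⟩
  suc o′ * suc n + o′            <⟨ ℕ.+-monoʳ-< (suc o′ * suc n) (ℕ.n<1+n o′) ⟩
  suc o′ * suc n + suc o′        ≡⟨ ring₂ n o′ ⟩
  suc o′ * suc (suc n)           ∎) le)
  where
  open ℕ.≤-Reasoning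
  ring₁ : ∀ n o′ → suc (suc o′) * suc n ≡ suc o′ * suc n + suc n
  ring₁ = ℕ-solve
  ring₂ : ∀ n o′ → suc o′ * suc n + suc o′ ≡ suc o′ * suc (suc n)
  ring₂ = ℕ-solve

-- An entry of digit p + s(n + 1) ≤ o′ moves to position q when an entry of digit o is inserted at
-- position g; if (o′ + 1)/(n + 1) ≤ (o + 1)/(n + 2), its digit q + s(n + 2) stays below o.
digit<digit-of-tie : ∀ n {s p o′ o g q} → s ≤ 1 → p < suc n → PositionOfDigit (suc (suc n)) o g → Shifted g p q →
  p + s * suc n ≤ o′ → suc o′ * suc (suc n) ≤ suc o * suc n → q + s * suc (suc n) < o
digit<digit-of-tie n {zero} {p} {o′} {o} _ p<m gap shift p+0≤o′ ratio = nonPositive shift gap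
  where
  p<o : p < o
  p<o = ℕ.≤-<-trans (subst (_≤ o′) (ℕ.+-identityʳ p) p+0≤o′) (digit<digit-of-ratio n ratio)
  nonPositive : ∀ {g q} → Shifted g p q → PositionOfDigit (suc (suc n)) o g → q + 0 < o
  nonPositive (inj₁ (_ , refl))   _                 = subst (_< o) (sym (ℕ.+-identityʳ p)) p<o
  nonPositive (inj₂ (g≤p , refl)) (inj₁ (_ , refl)) = ⊥-elim (ℕ.<⇒≱ p<o g≤p)
  nonPositive (inj₂ (g≤p , refl)) (inj₂ (N≤o , _))  =
    subst (_< o) (sym (ℕ.+-identityʳ (suc p))) (ℕ.<-≤-trans (s≤s p<m) N≤o)
digit<digit-of-tie n {suc zero} {p} {o′} {o} _ p<m gap shift p+m≤o′ ratio = positive shift gap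
  where
  m≤o′ : suc n ≤ o′
  m≤o′ = ℕ.≤-trans (ℕ.≤-trans (ℕ.≤-reflexive (sym (ℕ.+-identityʳ (suc n)))) (ℕ.m≤n+m _ p)) p+m≤o′
  p+N<o : p + 1 * suc (suc n) < o
  p+N<o = subst (_< o) (sym (ℕ.+-suc p (suc n + 0)))
            (ℕ.≤-<-trans (s≤s p+m≤o′) (suc-digit<digit-of-ratio n m≤o′ ratio))
  positive : ∀ {g q} → Shifted g p q → PositionOfDigit (suc (suc n)) o g → q + 1 * suc (suc n) < o
  positive (inj₁ (_ , refl))    _                     = p+N<o
  positive (inj₂ (g≤p , refl))  (inj₁ (o<N , _))      =
    ⊥-elim (ℕ.<-asym o<N (ℕ.≤-<-trans (ℕ.≤-trans (ℕ.≤-reflexive (sym (ℕ.+-identityʳ _))) (ℕ.m≤n+m _ p)) p+N<o))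
  positive (inj₂ (g≤p , refl))  (inj₂ (N≤o , refl))   =
    ⊥-elim (ℕ.<⇒≱ p+N<o (subst (_≤ p + 1 * suc (suc n)) (ℕ.m∸n+n≡m N≤o)
                           (subst (o ∸ suc (suc n) + suc (suc n) ≤_) (cong (_+_ p) (sym (ℕ.+-identityʳ _)))
                             (ℕ.+-monoˡ-≤ (suc (suc n)) g≤p))))
digit<digit-of-tie n {suc (suc s)} (s≤s ()) _ _ _ _ _

part-ratio-of-rank< : ∀ n {A s p q v o} → p + s * suc n < 2 * suc n → p < suc n → p ≤ q →
  o < 2 * suc (suc n) → A * (2 * suc (suc n)) + (q + s * suc (suc n)) < v * (2 * suc (suc n)) + o →
  part n A (p + s * suc n) * suc (suc n) ≤ part (suc n) v o * suc n
part-ratio-of-rank< n {A} {s} {p} {q} {v} {o} o′<D′ p<m p≤q o<D rank<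
  with radix-cancel-< (2 * suc (suc n)) A v o<D rank<
... | inj₁ A<v = part-ratio-of-< n (p + s * suc n) o A<v o′<D′
... | inj₂ (refl , qs<o) with A
...   | zero  = z≤n
...   | suc w = Equivalence.from (part-ratio-suc n w _ o) (digit-ratio-≤ n {s = s} p<m p≤q qs<o)

rank<-of-tie : ∀ n A {s p v′ o′ v o g q} → v′ ≡ A → v ≡ A → s ≤ 1 → (s ≡ 1 → 1 ≤ A) → p < suc n →
  (v ≡ 0 → o ≡ suc n) → PositionOfDigit (suc (suc n)) o g → Shifted g p q →
  A * (2 * suc n) + (p + s * suc n) ≤ v′ * (2 * suc n) + o′ →
  part n v′ o′ * suc (suc n) ≤ part (suc n) v o * suc n → q + s * suc (suc n) < o
rank<-of-tie n zero {zero} refl refl _ _ p<m v≡0⇒o≡m gap shift _ _ with v≡0⇒o≡m refl | gap | shift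
... | refl | inj₁ (_ , refl) | inj₁ (_ , refl)   = subst (_< suc n) (sym (ℕ.+-identityʳ _)) p<m
... | refl | inj₁ (_ , refl) | inj₂ (m≤p , _)   = ⊥-elim (ℕ.<⇒≱ p<m m≤p)
... | refl | inj₂ (N≤m , _)  | _                 = ⊥-elim (ℕ.1+n≰n N≤m)
rank<-of-tie n zero    {suc zero}    refl refl _ s≡1⇒1≤A = ⊥-elim (ℕ.1+n≰n (s≡1⇒1≤A refl))
rank<-of-tie n zero    {suc (suc s)} refl refl (s≤s ())
rank<-of-tie n (suc w) {s} {p} refl refl s≤1 _ p<m _ gap shift rank≤ ratio =
  digit<digit-of-tie n s≤1 p<m gap shift (ℕ.+-cancelˡ-≤ (suc w * (2 * suc n)) _ _ rank≤)
    (Equivalence.to (part-ratio-suc n w _ _) ratio)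

rank<-of-part-ratio : ∀ n {A s p v′ o′ v o g q} → s ≤ 1 → (s ≡ 1 → 1 ≤ A) → p < suc n →
  o′ < 2 * suc n → o < 2 * suc (suc n) → (v ≡ 0 → o ≡ suc n) →
  PositionOfDigit (suc (suc n)) o g → Shifted g p q →
  A * (2 * suc n) + (p + s * suc n) ≤ v′ * (2 * suc n) + o′ →
  part n v′ o′ * suc (suc n) ≤ part (suc n) v o * suc n →
  A * (2 * suc (suc n)) + (q + s * suc (suc n)) < v * (2 * suc (suc n)) + o
rank<-of-part-ratio n {A} {s} {p} {v′} {o′} {v} {o} {g} {q}
  s≤1 s≡1⇒1≤A p<m o′<D′ o<D v≡0⇒o≡m gap shift rank≤ ratio =
  compare (ℕ.m≤n⇒m<n∨m≡n (ℕ.≤-trans A≤v′ v′≤v))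
  where
  A≤v′ = radix-cancel-≤ (2 * suc n) A v′ o′<D′ rank≤
  v′≤v = abs≤abs-of-part-ratio n o<D ratio
  qs<D : q + s * suc (suc n) < 2 * suc (suc n)
  qs<D = subst (q + s * suc (suc n) <_) (1+m+1+m≡2*[1+m] (suc n))
           (ℕ.+-mono-<-≤ (shifted-< shift p<m) (b*n≤n (suc (suc n)) s≤1))
  compare : A < v ⊎ A ≡ v → A * (2 * suc (suc n)) + (q + s * suc (suc n)) < v * (2 * suc (suc n)) + o
  compare (inj₁ A<v) = radix-< (2 * suc (suc n)) o qs<D A<v
  compare (inj₂ A≡v) = subst (λ v → A * (2 * suc (suc n)) + (q + s * suc (suc n)) < v * (2 * suc (suc n)) + o) A≡v
    (ℕ.+-monoʳ-< (A * (2 * suc (suc n)))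
      (rank<-of-tie n A (ℕ.≤-antisym (ℕ.≤-trans v′≤v (ℕ.≤-reflexive (sym A≡v))) A≤v′) (sym A≡v)
        s≤1 s≡1⇒1≤A p<m v≡0⇒o≡m gap shift rank≤ ratio))

-- The encoding is a bijection onto lecture hall partitions

lectureHallStep-parts : ∀ {n} (l : Vec ℤ n) a b →
  LectureHallStep (suc n) (l ∷ʳ + a) (+ b) ⇔ a * suc (suc n) ≤ b * suc n
lectureHallStep-parts {n} l a b = mk⇔
  (λ step → ℤ.drop‿+≤+ (subst₂ ℤ._≤_ lhs≡ (sym (ℤ.pos-* b (suc n))) step))
  (λ le → subst₂ ℤ._≤_ (sym lhs≡) (ℤ.pos-* b (suc n)) (+≤+ le))
  where
  lhs≡ : lookup (l ∷ʳ + a) (fromℕ n) ℤ.* + suc (suc n) ≡ + (a * suc (suc n))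
  lhs≡ = trans (cong (ℤ._* + suc (suc n)) (lookup-∷ʳ-fromℕ l (+ a))) (sym (ℤ.pos-* a (suc (suc n))))

encode-step : ∀ {n} (x : Vec ℤ (suc (suc n))) →
  part n (topAbs (dropTop x)) (topDigit (dropTop x)) * suc (suc n) ≤ part (suc n) (topAbs x) (topDigit x) * suc n
encode-step {n} x =
  part-ratio-of-rank< n {∣ lookup x′ p ∣} {posBit (lookup x′ p)} {v = topAbs x} {o = topDigit x}
    (topDigit< x′) (Fin.toℕ<n p) (shifted-≤ (toℕ-punchIn (top x) p)) (topDigit< x) rank<
  where
  x′ = dropTop x
  p  = top x′
  rank< : ∣ lookup x′ p ∣ * (2 * suc (suc n)) + digit (punchIn (top x) p) (lookup x′ p) < rank x (top x)
  rank< = subst (λ z → ∣ z ∣ * (2 * suc (suc n)) + digit (punchIn (top x) p) z < rank x (top x))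
    (sym (lookup-removeAt x (top x) p)) (rank<rank[top] x (Fin.punchInᵢ≢i (top x) p))

encode-lectureHall : ∀ {m} (x : Vec ℤ m) → LectureHall m (encode x)
encode-lectureHall {zero}  [] ()
encode-lectureHall {suc m} x = Equivalence.from (lectureHall-∷ʳ _ _) (encode-lectureHall (dropTop x) , step m x)
  where
  step : ∀ m (x : Vec ℤ (suc m)) → LectureHallStep m (encode (dropTop x)) (+ part m (topAbs x) (topDigit x))
  step zero    x = +≤+ z≤n
  step (suc n) x = Equivalence.from (lectureHallStep-parts (encode (dropTop (dropTop x)))
    (part n (topAbs (dropTop x)) (topDigit (dropTop x))) (part (suc n) (topAbs x) (topDigit x))) (encode-step x)

top-decode-step : ∀ {n} (x′ : Vec ℤ (suc n)) k →
  part n (topAbs x′) (topDigit x′) * suc (suc n) ≤ part (suc n) (partAbs (suc n) k) (partDigit (suc n) k) * suc n →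
  top (insertEntry x′ (entryOfPart (suc n) k)) ≡ proj₁ (entryOfPart (suc n) k)
top-decode-step {n} x′ k ratio = top-dominant x g dominant
  where
  g = proj₁ (entryOfPart (suc n) k)
  y = proj₂ (entryOfPart (suc n) k)
  x = insertAt x′ g y
  D = 2 * suc (suc n)
  rank-g : rank x g ≡ partAbs (suc n) k * D + partDigit (suc n) k
  rank-g = trans (cong (λ z → ∣ z ∣ * D + digit g z) (Vec.insertAt-lookup x′ g y))
                 (cong₂ (λ a o → a * D + o) (proj₁ (entryOfPart-abs-digit (suc n) k))
                                            (proj₂ (entryOfPart-abs-digit (suc n) k)))
  dominant : ∀ p → rank x (punchIn g p) < rank x g
  dominant p = subst₂ _<_
    (cong (λ z → ∣ z ∣ * D + digit (punchIn g p) z) (sym (Vec.insertAt-punchIn x′ g y p)))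
    (sym rank-g)
    (rank<-of-part-ratio n {v′ = topAbs x′} {o′ = topDigit x′}
      (posBit≤1 (lookup x′ p)) (posBit≡1⇒1≤∣z∣ (lookup x′ p)) (Fin.toℕ<n p) (topDigit< x′) (partDigit< (suc n) k)
      (partAbs≡0⇒partDigit≡m (suc n) k) (entryOfDigit-position (suc n) _ _ _) (toℕ-punchIn g p)
      (f≤f[argmax] (rank x′) p) ratio)

encode-top : ∀ {m} (x : Vec ℤ (suc m)) g → top x ≡ g →
  encode x ≡ encode (removeAt x g) ∷ʳ + part m ∣ lookup x g ∣ (digit g (lookup x g))
encode-top x g refl = refl

+part≡last : ∀ {m} (l : Vec ℤ (suc m)) → LectureHall (suc m) l →
  + part m (partAbs m ∣ last l ∣) (partDigit m ∣ last l ∣) ≡ last l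
+part≡last {m} l lh =
  trans (cong +_ (part-partAbs-partDigit m ∣ last l ∣)) (ℤ.0≤i⇒+∣i∣≡i (lectureHall-last-nonNeg l lh))

top-decode : ∀ {m} (l : Vec ℤ (suc m)) → LectureHall (suc m) l → encode (decode (init l)) ≡ init l →
  top (decode l) ≡ proj₁ (entryOfPart m ∣ last l ∣)
top-decode {zero}  l _  _ = top-dominant (decode l) _ (λ ())
top-decode {suc n} l lh encode-decode-init = top-decode-step x′ k
  (Equivalence.to (lectureHallStep-parts (encode (dropTop x′)) (part n (topAbs x′) (topDigit x′))
                                          (part (suc n) (partAbs (suc n) k) (partDigit (suc n) k)))
    (subst₂ (LectureHallStep (suc n)) (sym encode-decode-init) (sym (+part≡last l lh))
            (proj₂ (lectureHall-init l lh))))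
  where
  x′ = decode (init l)
  k  = ∣ last l ∣

encode-decode : ∀ {m} (l : Vec ℤ m) → LectureHall m l → encode (decode l) ≡ l
encode-decode {zero}  [] _  = refl
encode-decode {suc m} l  lh = begin
  encode (insertAt x′ g y)
    ≡⟨ encode-top (insertAt x′ g y) g (top-decode l lh ih) ⟩
  encode (removeAt (insertAt x′ g y) g) ∷ʳ (+ part m ∣ y′ ∣ (digit g y′))
    ≡⟨ cong₂ (λ x z → encode x ∷ʳ (+ part m ∣ z ∣ (digit g z)))
             (Vec.removeAt-insertAt x′ g y) (Vec.insertAt-lookup x′ g y) ⟩
  encode x′ ∷ʳ (+ part m ∣ y ∣ (digit g y))
    ≡⟨ cong₂ _∷ʳ_ ih (trans (cong +_ (part-entryOfPart m ∣ last l ∣))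
                            (ℤ.0≤i⇒+∣i∣≡i (lectureHall-last-nonNeg l lh))) ⟩
  init l ∷ʳ last l
    ≡⟨ init-∷ʳ-last l ⟩
  l ∎
  where
  open ≡-Reasoning
  x′ = decode (init l)
  g  = proj₁ (entryOfPart m ∣ last l ∣)
  y  = proj₂ (entryOfPart m ∣ last l ∣)
  y′ = lookup (insertAt x′ g y) g
  ih : encode x′ ≡ init l
  ih = encode-decode (init l) (proj₁ (lectureHall-init l lh))

-- Exponents and the facets of C

ceiling-part : ∀ m v {o} → o < 2 * suc m → ceiling (+ part m v o ℚ./ (2 * suc m)) ≡ + v
ceiling-part m v {o} o<D = ceiling-/-unique (+ part m v o) (m + suc (m + 0)) (+ v) (below v) above
  where
  above : + part m v o ℤ.≤ + v ℤ.* + (2 * suc m)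
  above = subst (+ part m v o ℤ.≤_) (ℤ.pos-* v (2 * suc m)) (+≤+ (part≤abs* m v o<D))
  below : ∀ v → ℤ.pred (+ v) ℤ.* + (2 * suc m) ℤ.< + part m v o
  below zero    = ℤ.-<+
  below (suc w) = subst (ℤ._< + part m (suc w) o) (ℤ.pos-* w (2 * suc m)) (+<+ (s≤s (ℕ.m≤m+n _ o)))

ceilingSum : ∀ {m} → (Fin m → ℤ) → Vec ℤ m → ℤ
ceilingSum α l = sumℤ (λ i → α i ℤ.* ceiling (lookup l i ℚ./ (2 * suc (toℕ i))))

ceilingSum-encode : ∀ {m} (α : Fin m → ℤ) (x : Vec ℤ m) → ceilingSum α (encode x) ≡ sortedSum α x
ceilingSum-encode {zero}  α x = refl
ceilingSum-encode {suc m} α x = begin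
  sumℤ f
    ≡⟨ sumℤ-fromℕ f ⟩
  sumℤ (f ∘ inject₁) ℤ.+ f (fromℕ m)
    ≡⟨ cong₂ ℤ._+_ (trans (sumℤ-cong f∘inject₁≡) (ceilingSum-encode (α ∘ inject₁) x′)) f-last≡ ⟩
  sortedSum α x
    ∎
  where
  open ≡-Reasoning
  x′ = dropTop x
  λₘ = + part m (topAbs x) (topDigit x)
  f : Fin (suc m) → ℤ
  f i = α i ℤ.* ceiling (lookup (encode x′ ∷ʳ λₘ) i ℚ./ (2 * suc (toℕ i)))
  f∘inject₁≡ : ∀ i → f (inject₁ i) ≡ α (inject₁ i) ℤ.* ceiling (lookup (encode x′) i ℚ./ (2 * suc (toℕ i)))
  f∘inject₁≡ i = cong (λ q → α (inject₁ i) ℤ.* ceiling q)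
    (ℚ./-cong (lookup-∷ʳ-inject₁ (encode x′) λₘ i) (cong (λ j → 2 * suc j) (Fin.toℕ-inject₁ i)))
  f-last≡ : f (fromℕ m) ≡ α (fromℕ m) ℤ.* + topAbs x
  f-last≡ = cong (α (fromℕ m) ℤ.*_) (trans
    (cong ceiling (ℚ./-cong (lookup-∷ʳ-fromℕ (encode x′) λₘ) (cong (λ j → 2 * suc j) (Fin.toℕ-fromℕ m))))
    (ceiling-part m (topAbs x) (topDigit< x)))

applySign-≤ : ∀ s {a} z → + 0 ℤ.≤ a → applySign s (a ℤ.* z) ℤ.≤ a ℤ.* + ∣ z ∣
applySign-≤ Sign.+ (+ n)      _   = ℤ.≤-refl
applySign-≤ Sign.+ {a} -[1+ n ] 0≤a = ℤ.*-monoˡ-≤-nonNeg a -≤+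
  where instance _ = ℤ.nonNegative 0≤a
applySign-≤ Sign.- {a} z 0≤a =
  subst (ℤ._≤ a ℤ.* + ∣ z ∣) (sym (ℤ.neg-distribʳ-* a z)) (ℤ.*-monoˡ-≤-nonNeg a (-z≤∣z∣ z))
  where
  instance _ = ℤ.nonNegative 0≤a
  -z≤∣z∣ : ∀ z → - z ℤ.≤ + ∣ z ∣
  -z≤∣z∣ (+ zero)  = ℤ.≤-refl
  -z≤∣z∣ +[1+ n ]  = -≤+
  -z≤∣z∣ -[1+ n ]  = ℤ.≤-refl

applySign-sign : ∀ a z → applySign (ℤ.sign z) (a ℤ.* z) ≡ a ℤ.* + ∣ z ∣
applySign-sign a (+ n)      = refl
applySign-sign a -[1+ n ]   = ℤ.neg-distribʳ-* a -[1+ n ]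

-- The signs of the entries and the sorting permutation are optimal, because the coefficients are
-- nonnegative and increasing.
signedSums≤⇔sortedSum≤ : ∀ {m} (α : Fin m → ℤ) → (∀ i → + 0 ℤ.≤ α i) → Monotone α →
  ∀ (x : Vec ℤ m) k →
  (∀ (π : Permutation′ m) (ε : Fin m → Sign) →
     sumℤ (λ i → applySign (ε i) (α i ℤ.* lookup x (π ⟨$⟩ʳ i))) ℤ.≤ k)
  ⇔ sortedSum α x ℤ.≤ k
signedSums≤⇔sortedSum≤ α α≥0 mono x k = mk⇔
  (λ all≤k → subst (ℤ._≤ k) (trans (sumℤ-cong (λ i → applySign-sign (α i) (lookup x (π ⟨$⟩ʳ i)))) π-attains)
                            (all≤k π (λ i → ℤ.sign (lookup x (π ⟨$⟩ʳ i)))))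
  (λ sorted≤k π ε → ℤ.≤-trans (sumℤ-mono-≤ (λ i → applySign-≤ (ε i) (lookup x (π ⟨$⟩ʳ i)) (α≥0 i)))
                      (ℤ.≤-trans (permutedSum≤sortedSum α mono π x) sorted≤k))
  where
  π = proj₁ (sortedSum-attained α x)
  π-attains = proj₂ (sortedSum-attained α x)

private
  bonus-nonNeg : ∀ t b → + 0 ℤ.≤ (if t then + b else + 0)
  bonus-nonNeg true  b = +≤+ z≤n
  bonus-nonNeg false b = +≤+ z≤n

coeff-nonNeg : ∀ m d c b → - + (2 * d) ℤ.≤ c → ∀ i → + 0 ℤ.≤ coeff m d c b i
coeff-nonNeg m d c b -2d≤c i = ℤ.+-mono-≤ 2di+c-nonNeg (bonus-nonNeg (suc (toℕ i) ≡ᵇ m) b)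
  where
  2d≤2di : 2 * d ≤ 2 * d * suc (toℕ i)
  2d≤2di = subst (_≤ 2 * d * suc (toℕ i)) (ℕ.*-identityʳ (2 * d)) (ℕ.*-monoʳ-≤ (2 * d) (s≤s z≤n))
  2di+c-nonNeg : + 0 ℤ.≤ + (2 * d * suc (toℕ i)) ℤ.+ c
  2di+c-nonNeg = ℤ.≤-trans (ℤ.≤-reflexive (sym (ℤ.+-inverseʳ (+ (2 * d))))) (ℤ.+-mono-≤ (+≤+ 2d≤2di) -2d≤c)

-- Only the last coefficient carries the extra b, so the increase 2d from one index to the next persists.
coeff-monotone : ∀ m d c b → Monotone (coeff m d c b)
coeff-monotone m d c b {i} {j} i≤j with ℕ.m≤n⇒m<n∨m≡n i≤j
... | inj₂ i≡j rewrite Fin.toℕ-injective {i = i} {j = j} i≡j = ℤ.≤-refl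
... | inj₁ i<j with suc (toℕ i) ≡ᵇ m in i-last
...   | true  = ⊥-elim (ℕ.<⇒≱ (Fin.toℕ<n j)
                  (subst (_≤ toℕ j) (ℕ.≡ᵇ⇒≡ (suc (toℕ i)) m (subst T (sym i-last) tt)) i<j))
...   | false = ℤ.+-mono-≤ (ℤ.+-monoˡ-≤ c (+≤+ (ℕ.*-monoʳ-≤ (2 * d) (ℕ.<⇒≤ (s≤s i<j)))))
                           (bonus-nonNeg (suc (toℕ j) ≡ᵇ m) b)

sortedSum-decode : ∀ {m} (α : Fin m → ℤ) l → LectureHall m l → sortedSum α (decode l) ≡ ceilingSum α l
sortedSum-decode α l lh = trans (sym (ceilingSum-encode α (decode l))) (cong (ceilingSum α) (encode-decode l lh))

corollary4p6 : (m d b : ℕ) (c : ℤ) → - (+ (2 * d)) ℤ.≤ c →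
  ¬ (d ≡ 0 × c ≡ + 0 × b ≡ 0) → (k : ℤ) →
  SubsetBijection {Vec ℤ m} {Vec ℤ m}
    (λ x → InC m d c b x k)
    (λ l → LectureHall m l × lhExponent m d c b l ℤ.≤ k)
corollary4p6 m d b c -2d≤c _ k = record
  { to       = encode
  ; from     = decode
  ; to-mem   = λ x x∈C → encode-lectureHall x
                       , subst (ℤ._≤ k) (sym (ceilingSum-encode α x)) (Equivalence.to (inC⇔ x) x∈C)
  ; from-mem = λ l (lh , l≤k) → Equivalence.from (inC⇔ (decode l))
                       (subst (ℤ._≤ k) (sym (sortedSum-decode α l lh)) l≤k)
  ; from∘to  = λ x _ → decode-encode x
  ; to∘from  = λ l (lh , _) → encode-decode l lh
  }
  where
  α = coeff m d c b
  inC⇔ : ∀ x → InC m d c b x k ⇔ sortedSum α x ℤ.≤ k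
  inC⇔ x = signedSums≤⇔sortedSum≤ α (coeff-nonNeg m d c b -2d≤c) (coeff-monotone m d c b) x k
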